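{- Let $A$ be a $(0,1,\ast)$-matrix with $n$ columns and column min-rank $r$. Then $\mathrm{opt}(A)\leq 2^{n-r}$.
   Context: A $(0,1,\ast)$-matrix is a matrix with entries in $\{0,1,\ast\}$; all arithmetic is over $GF_2$. A completion of $A$ is a $(0,1)$-matrix obtained from $A$ by replacing each $\ast$ by $0$ or $1$. For an $m$-by-$n$ $(0,1,\ast)$-matrix $A=(a_{ij})$, an operator $G=(g_1,\dots,g_m):\{0,1\}^n\to\{0,1\}^m$ is consistent with $A$ if each $g_i$ depends only on the variables $x_j$ with $a_{ij}=\ast$. A set $L\subseteq\{0,1\}^n$ is a solution for $A$ if there exist a completion $M$ of $A$ and an operator $G$ consistent with $A$ such that $M\mathbf{x}=G(\mathbf{x})$ for all $\mathbf{x}\in L$; $\mathrm{opt}(A)$ is the maximum size of a solution for $A$. A collection of $(0,1,\ast)$-vectors is dependent if its $\ast$-entries can be set to constants $0,1$ so that the resulting $(0,1)$-vectors are linearly dependent over $GF_2$; otherwise it is independent. The column min-rank of $A$ is the maximum number of independent columns of $A$. -}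

module Defs where

open import Data.Nat using (ℕ; _≤_; _^_; _∸_)
open import Data.Bool using (Bool; true; false; _∧_; _xor_)
open import Data.Fin using (Fin)
open import Data.Vec using (Vec; []; _∷_; lookup)
open import Data.List using (List; length; foldr; map)
open import Data.List.Relation.Unary.All using (All)
open import Data.List.Relation.Unary.Any using (Any)
open import Data.List.Relation.Unary.Unique.Propositional using (Unique)
open import Data.Product using (Σ; _×_)
open import Relation.Binary.PropositionalEquality using (_≡_)
open import Relation.Nullary using (¬_)

data Entry : Set where
  e0 e1 ⋆ : Entry

Matrix : ℕ → ℕ → Set
Matrix m n = Fin m → Fin n → Entry

BMatrix : ℕ → ℕ → Set
BMatrix m n = Fin m → Fin n → Bool

Completion : ∀ {m n} → Matrix m n → BMatrix m n → Set
Completion A M = ∀ i j → (A i j ≡ e0 → M i j ≡ false) × (A i j ≡ e1 → M i j ≡ true)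

xorSum : List Bool → Bool
xorSum = foldr _xor_ false

dot : ∀ {n} → (Fin n → Bool) → Vec Bool n → Bool
dot {n} r [] = false
dot r (x ∷ xs) = (r Fin.zero ∧ x) xor dot (λ j → r (Fin.suc j)) xs
  where import Data.Fin as Fin

-- operator G = (g_1,...,g_m) : {0,1}^n → {0,1}^m, given by its coordinate functions
Operator : ℕ → ℕ → Set
Operator m n = Fin m → Vec Bool n → Bool

Consistent : ∀ {m n} → Matrix m n → Operator m n → Set
Consistent {m} {n} A G =
  ∀ i (x y : Vec Bool n) → (∀ j → A i j ≡ ⋆ → lookup x j ≡ lookup y j) → G i x ≡ G i y

IsSolution : ∀ {m n} → Matrix m n → List (Vec Bool n) → Set
IsSolution {m} {n} A L =
  Σ (BMatrix m n) λ M → Completion A M ×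
  Σ (Operator m n) λ G → Consistent A G ×
  All (λ x → ∀ i → dot (M i) x ≡ G i x) L

-- the collection of columns of A indexed by S (distinct indices) is dependent:
-- the *-entries can be set (a completion M) so that the resulting columns are
-- linearly dependent over GF(2), i.e. some nontrivial GF(2)-combination vanishes
DependentCols : ∀ {m n} → Matrix m n → List (Fin n) → Set
DependentCols {m} {n} A S =
  Σ (BMatrix m n) λ M → Completion A M ×
  Σ (Fin n → Bool) λ c → Any (λ j → c j ≡ true) S ×
  (∀ i → xorSum (map (λ j → c j ∧ M i j) S) ≡ false)

IndependentCols : ∀ {m n} → Matrix m n → List (Fin n) → Set
IndependentCols A S = ¬ DependentCols A S

IsColMinRank : ∀ {m n} → Matrix m n → ℕ → Set
IsColMinRank {m} {n} A r =
  (Σ (List (Fin n)) λ S → Unique S × length S ≡ r × IndependentCols A S) ×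
  (∀ (S : List (Fin n)) → Unique S → IndependentCols A S → length S ≤ r)

OptAtMost : ∀ {m n} → Matrix m n → ℕ → Set
OptAtMost {m} {n} A k = ∀ (L : List (Vec Bool n)) → Unique L → IsSolution A L → length L ≤ k

-- Fix r independent columns S and a solution L, realised by a completion M and
-- an operator G. If two distinct x, y ∈ L agreed off S, then z = x + y would be a
-- nonzero vector supported on S. In each row i either M_i z = g_i(x) + g_i(y) is
-- already 0, or g_i(x) ≠ g_i(y); then, g_i being consistent with A, x and y
-- differ at some ⋆-position of row i, and flipping that entry of M makes
-- M_i z = 0. The corrected completion kills z, so the columns S would be
-- dependent. Hence the vectors of L are pairwise distinct off S. Toggling one
-- coordinate s ∈ S doubles such a family while keeping it pairwise distinct off
-- S ∖ {s}, so |L| · 2^r ≤ 2^n.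
module Submission where

open import Defs
open import Data.Nat using (ℕ; _^_; _∸_)
open import Data.Nat.Base using (suc; _+_; _*_; _≤_)
import Data.Nat.Properties as ℕ
open import Data.Nat.Solver using (module +-*-Solver)
open import Data.Bool.Base using (Bool; true; false; not; _∧_; _xor_)
open import Data.Bool.Properties as Bool
  using (∧-comm; ∧-zeroʳ; ∧-distribˡ-xor; xor-assoc; xor-same; xor-inverseˡ; ¬-not; not-¬;
         xor-∧-commutativeRing)
open import Data.Fin.Base as Fin using (Fin; funToFin; finToFun)
open import Data.Fin.Properties using (_≟_; 2↔Bool; finToFun-funToFin; injective⇒≤; ¬∀⟶∃¬)
open import Data.Vec.Base using (Vec; []; _∷_; lookup; zipWith; tabulate; updateAt)
open import Data.Vec.Properties
  using (lookup-zipWith; lookup∘tabulate; lookup∘updateAt; lookup∘updateAt′; tabulate∘lookup; tabulate-cong)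
import Data.Vec.Functional as Vector
import Data.Vec.Functional.Properties as Vector
open import Data.List.Base as List using (List; []; _∷_; length; map; _++_)
open import Data.List.Properties using (map-cong-local; length-++; length-map)
open import Data.List.Relation.Unary.All as All using (All; []; _∷_)
import Data.List.Relation.Unary.All.Properties as All
open import Data.List.Relation.Unary.Any as Any using (Any; here; there)
open import Data.List.Relation.Unary.AllPairs as AllPairs using (AllPairs; []; _∷_)
import Data.List.Relation.Unary.AllPairs.Properties as AllPairs
open import Data.List.Relation.Unary.Unique.Propositional using (Unique)
open import Data.List.Membership.Propositional using (_∈_; _∉_)
open import Data.List.Membership.Propositional.Properties using (∈-lookup)
open import Data.List.Relation.Binary.Subset.Propositional using (_⊆_)
open import Data.Product.Base using (∃; _×_; _,_; proj₁; proj₂)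
open import Function.Base using (_∘_; const)
open import Function.Bundles using (Inverse)
open import Algebra.Bundles using (CommutativeRing)
open import Algebra.Properties.CommutativeSemigroup
  (CommutativeRing.+-commutativeSemigroup xor-∧-commutativeRing) using (interchange; x∙yz≈y∙xz)
open import Relation.Binary.PropositionalEquality
open import Relation.Nullary using (¬_; Dec; yes; no; contradiction)
open import Relation.Nullary.Decidable using (_→-dec_; decidable-stable)

private
  variable
    m n : ℕ

dot-zipWith-xor : (r : Fin n → Bool) (x y : Vec Bool n) →
                  dot r (zipWith _xor_ x y) ≡ dot r x xor dot r y
dot-zipWith-xor r []      []      = refl
dot-zipWith-xor r (a ∷ x) (b ∷ y) = begin
  (r Fin.zero ∧ (a xor b)) xor dot (r ∘ Fin.suc) (zipWith _xor_ x y)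
    ≡⟨ cong₂ _xor_ (∧-distribˡ-xor (r Fin.zero) a b) (dot-zipWith-xor (r ∘ Fin.suc) x y) ⟩
  ((r Fin.zero ∧ a) xor (r Fin.zero ∧ b)) xor (dot (r ∘ Fin.suc) x xor dot (r ∘ Fin.suc) y)
    ≡⟨ interchange (r Fin.zero ∧ a) (r Fin.zero ∧ b) (dot (r ∘ Fin.suc) x) (dot (r ∘ Fin.suc) y) ⟩
  ((r Fin.zero ∧ a) xor dot (r ∘ Fin.suc) x) xor ((r Fin.zero ∧ b) xor dot (r ∘ Fin.suc) y) ∎
  where open ≡-Reasoning

dot-updateAt-not : (r : Fin n → Bool) (z : Vec Bool n) (j : Fin n) →
                   dot (Vector.updateAt r j not) z ≡ lookup z j xor dot r z
dot-updateAt-not r (a ∷ z) Fin.zero    = not-∧-xor (r Fin.zero)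
  where
  not-∧-xor : ∀ c {d} → (not c ∧ a) xor d ≡ a xor ((c ∧ a) xor d)
  not-∧-xor false   = refl
  not-∧-xor true {d} = sym (trans (sym (xor-assoc a a d)) (cong (_xor d) (xor-same a)))
dot-updateAt-not r (a ∷ z) (Fin.suc j) =
  trans (cong ((r Fin.zero ∧ a) xor_) (dot-updateAt-not (r ∘ Fin.suc) z j))
        (x∙yz≈y∙xz (r Fin.zero ∧ a) (lookup z j) (dot (r ∘ Fin.suc) z))

dot-split : (r : Fin n → Bool) (z : Vec Bool n) (s : Fin n) →
            dot r z ≡ (lookup z s ∧ r s) xor dot r (updateAt z s (const false))
dot-split r (a ∷ z) Fin.zero    =
  cong₂ _xor_ (∧-comm (r Fin.zero) a) (cong (_xor dot (r ∘ Fin.suc) z) (sym (∧-zeroʳ (r Fin.zero))))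
dot-split r (a ∷ z) (Fin.suc s) =
  trans (cong ((r Fin.zero ∧ a) xor_) (dot-split (r ∘ Fin.suc) z s))
        (x∙yz≈y∙xz (r Fin.zero ∧ a) (lookup z s ∧ r (Fin.suc s)) _)

dot-zeroʳ : (r : Fin n → Bool) (z : Vec Bool n) → (∀ j → lookup z j ≡ false) → dot r z ≡ false
dot-zeroʳ r []      _    = refl
dot-zeroʳ r (a ∷ z) z≡0 =
  cong₂ _xor_ (trans (cong (r Fin.zero ∧_) (z≡0 Fin.zero)) (∧-zeroʳ (r Fin.zero)))
              (dot-zeroʳ (r ∘ Fin.suc) z (z≡0 ∘ Fin.suc))

xorSum-support : (r : Fin n → Bool) (z : Vec Bool n) {S : List (Fin n)} → Unique S →
                 (∀ j → lookup z j ≡ true → j ∈ S) →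
                 xorSum (map (λ j → lookup z j ∧ r j) S) ≡ dot r z
xorSum-support r z []           supp =
  sym (dot-zeroʳ r z (λ j → ¬-not (λ zj → contradiction (supp j zj) λ ())))
xorSum-support r z {s ∷ S} (s∉S ∷ uniqueS) supp = begin
  (lookup z s ∧ r s) xor xorSum (map (λ j → lookup z j ∧ r j) S)
    ≡⟨ cong (λ l → (lookup z s ∧ r s) xor xorSum l) (map-cong-local (All.map off-s s∉S)) ⟩
  (lookup z s ∧ r s) xor xorSum (map (λ j → lookup z′ j ∧ r j) S)
    ≡⟨ cong ((lookup z s ∧ r s) xor_) (xorSum-support r z′ uniqueS supp′) ⟩
  (lookup z s ∧ r s) xor dot r z′
    ≡⟨ dot-split r z s ⟨
  dot r z ∎
  where
  open ≡-Reasoning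
  z′ : Vec Bool _
  z′ = updateAt z s (const false)
  off-s : ∀ {j} → s ≢ j → lookup z j ∧ r j ≡ lookup z′ j ∧ r j
  off-s s≢j = cong (_∧ r _) (sym (lookup∘updateAt′ _ s (s≢j ∘ sym) z))
  supp′ : ∀ j → lookup z′ j ≡ true → j ∈ S
  supp′ j z′j with j ≟ s
  ... | yes refl = contradiction (trans (sym (lookup∘updateAt s z)) z′j) λ ()
  ... | no j≢s with supp j (trans (sym (lookup∘updateAt′ j s j≢s z)) z′j)
  ...   | here j≡s = contradiction j≡s j≢s
  ...   | there j∈S = j∈S

-- Correcting one row of a completion

RowCompletion : (Fin n → Entry) → (Fin n → Bool) → Set
RowCompletion a r = ∀ j → (a j ≡ e0 → r j ≡ false) × (a j ≡ e1 → r j ≡ true)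

rowCompletion-updateAt-⋆ : ∀ {a : Fin n → Entry} {r j} (f : Bool → Bool) → a j ≡ ⋆ →
                           RowCompletion a r → RowCompletion a (Vector.updateAt r j f)
rowCompletion-updateAt-⋆ {r = r} {j} f a⋆ completes k with k ≟ j
... | yes refl rewrite a⋆ = (λ ()) , (λ ())
... | no k≢j rewrite Vector.updateAt-minimal k j {f} r k≢j = completes k

rowCompletion-annihilating : (a : Fin n → Entry) (r : Fin n → Bool) (z : Vec Bool n) →
  RowCompletion a r → (dot r z ≡ true → ∃ λ j → a j ≡ ⋆ × lookup z j ≡ true) →
  ∃ λ r′ → RowCompletion a r′ × dot r′ z ≡ false
rowCompletion-annihilating a r z completes hit with dot r z in rz
... | false = r , completes , rz
... | true with hit refl
...   | j , a⋆ , zj = Vector.updateAt r j not , rowCompletion-updateAt-⋆ not a⋆ completes ,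
                       trans (dot-updateAt-not r z j) (cong₂ _xor_ zj rz)

-- Agreeing solution vectors

record AgreeOutside (S : List (Fin n)) (x y : Vec Bool n) : Set where
  constructor agreeOutside
  field agree : ∀ j → j ∉ S → lookup x j ≡ lookup y j
open AgreeOutside

Solves : BMatrix m n → Operator m n → Vec Bool n → Set
Solves M G x = ∀ i → dot (M i) x ≡ G i x

_≟⋆ : (e : Entry) → Dec (e ≡ ⋆)
e0 ≟⋆ = no λ ()
e1 ≟⋆ = no λ ()
⋆  ≟⋆ = yes refl

lookup-ext : {x y : Vec Bool n} → (∀ j → lookup x j ≡ lookup y j) → x ≡ y
lookup-ext {x = x} {y} x≗y =
  trans (sym (tabulate∘lookup x)) (trans (tabulate-cong x≗y) (tabulate∘lookup y))

xor≡true⇒≢ : ∀ {a b} → a xor b ≡ true → a ≢ b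
xor≡true⇒≢ {a} a+b≡1 refl = contradiction (trans (sym (xor-same a)) a+b≡1) λ ()

≢⇒xor≡true : ∀ {a b} → a ≢ b → a xor b ≡ true
≢⇒xor≡true {b = b} a≢b = trans (cong (_xor b) (¬-not a≢b)) (xor-inverseˡ b)

disagreement-at-⋆ : (a : Fin n → Entry) (x y : Vec Bool n) →
  ¬ (∀ j → a j ≡ ⋆ → lookup x j ≡ lookup y j) → ∃ λ j → a j ≡ ⋆ × lookup x j ≢ lookup y j
disagreement-at-⋆ {n} a x y ¬agree
  with ¬∀⟶∃¬ n _ (λ j → (a j ≟⋆) →-dec (lookup x j Bool.≟ lookup y j)) ¬agree
... | j , ¬implies =
  j , decidable-stable (a j ≟⋆) (λ ¬⋆ → ¬implies (λ ⋆ → contradiction ⋆ ¬⋆)) ,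
  λ xj≡yj → ¬implies (const xj≡yj)

agreeing-solutions⇒dependent : ∀ {A : Matrix m n} {M G} → Completion A M → Consistent A G →
  ∀ {x y} → Solves M G x → Solves M G y → x ≢ y →
  ∀ {S} → Unique S → AgreeOutside S x y → DependentCols A S
agreeing-solutions⇒dependent {A = A} {M} {G} completes consistent {x} {y} sx sy x≢y {S} uniqueS
                             agrees =
  (λ i → proj₁ (corrected i)) , (λ i → proj₁ (proj₂ (corrected i))) , lookup z ,
  z-nonzero , λ i → trans (xorSum-support _ z uniqueS support) (proj₂ (proj₂ (corrected i)))
  where
  z : Vec Bool _
  z = zipWith _xor_ x y
  x≢y⇒z≡1 : ∀ j → lookup x j ≢ lookup y j → lookup z j ≡ true
  x≢y⇒z≡1 j xj≢yj = trans (lookup-zipWith _xor_ j x y) (≢⇒xor≡true xj≢yj)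
  support : ∀ j → lookup z j ≡ true → j ∈ S
  support j zj with Any.any? (j ≟_) S
  ... | yes j∈S = j∈S
  ... | no j∉S  = contradiction (agree agrees j j∉S)
                                (xor≡true⇒≢ (trans (sym (lookup-zipWith _xor_ j x y)) zj))
  z-nonzero : Any (λ j → lookup z j ≡ true) S
  z-nonzero with ¬∀⟶∃¬ _ _ (λ j → lookup x j Bool.≟ lookup y j) (x≢y ∘ lookup-ext)
  ... | j , xj≢yj = Any.map (λ { refl → x≢y⇒z≡1 j xj≢yj }) (support j (x≢y⇒z≡1 j xj≢yj))
  Mz≡Gx+Gy : ∀ i → dot (M i) z ≡ G i x xor G i y
  Mz≡Gx+Gy i = trans (dot-zipWith-xor (M i) x y) (cong₂ _xor_ (sx i) (sy i))
  hit : ∀ i → dot (M i) z ≡ true → ∃ λ j → A i j ≡ ⋆ × lookup z j ≡ true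
  hit i Mz≡1 with disagreement-at-⋆ (A i) x y
                    (xor≡true⇒≢ (trans (sym (Mz≡Gx+Gy i)) Mz≡1) ∘ consistent i x y)
  ... | j , a⋆ , xj≢yj = j , a⋆ , x≢y⇒z≡1 j xj≢yj
  corrected : ∀ i → ∃ λ r → RowCompletion (A i) r × dot r z ≡ false
  corrected i = rowCompletion-annihilating (A i) (M i) z (completes i) (hit i)

-- Families that are pairwise distinct off S

agreeOutside-refl : ∀ {S : List (Fin n)} {x} → AgreeOutside S x x
agreeOutside-refl = agreeOutside λ _ _ → refl

agreeOutside-sym : ∀ {S : List (Fin n)} {x y} → AgreeOutside S x y → AgreeOutside S y x
agreeOutside-sym x~y = agreeOutside λ j j∉S → sym (agree x~y j j∉S)

agreeOutside-trans : ∀ {S : List (Fin n)} {x y z} →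
                     AgreeOutside S x y → AgreeOutside S y z → AgreeOutside S x z
agreeOutside-trans x~y y~z = agreeOutside λ j j∉S → trans (agree x~y j j∉S) (agree y~z j j∉S)

agreeOutside-mono : ∀ {S T : List (Fin n)} {x y} → S ⊆ T → AgreeOutside S x y → AgreeOutside T x y
agreeOutside-mono S⊆T x~y = agreeOutside λ j j∉T → agree x~y j (j∉T ∘ S⊆T)

toggle : Fin n → Vec Bool n → Vec Bool n
toggle s x = updateAt x s not

agreeOutside-toggle : ∀ {s} {S : List (Fin n)} x → AgreeOutside (s ∷ S) x (toggle s x)
agreeOutside-toggle {s = s} x =
  agreeOutside λ j j∉s∷S → sym (lookup∘updateAt′ j s (j∉s∷S ∘ here) x)

¬agreeOutside-toggle : ∀ {s} {S : List (Fin n)} → s ∉ S → ∀ x → ¬ AgreeOutside S x (toggle s x)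
¬agreeOutside-toggle {s = s} s∉S x x~x′ =
  not-¬ refl (trans (agree x~x′ s s∉S) (lookup∘updateAt s x))

agreeOutside-toggleʳ : ∀ {s} {S : List (Fin n)} {x y} →
                       AgreeOutside S x (toggle s y) → AgreeOutside (s ∷ S) x y
agreeOutside-toggleʳ {y = y} x~y′ =
  agreeOutside-trans (agreeOutside-mono there x~y′) (agreeOutside-sym (agreeOutside-toggle y))

Separated : List (Fin n) → List (Vec Bool n) → Set
Separated S = AllPairs (λ x y → ¬ AgreeOutside S x y)

allPairs-mapWithAll : ∀ {A : Set} {P : A → Set} {R T : A → A → Set} →
  (∀ {x y} → P x → P y → R x y → T x y) → ∀ {xs} → All P xs → AllPairs R xs → AllPairs T xs
allPairs-mapWithAll f []         []           = []
allPairs-mapWithAll f (px ∷ pxs) (Rx ∷ Rxs) =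
  All.zipWith (λ (py , r) → f px py r) (pxs , Rx) ∷ allPairs-mapWithAll f pxs Rxs

allPairs⇒all-all : ∀ {A : Set} {R T : A → A → Set} → (∀ {x} → T x x) →
  (∀ {x y} → R x y → T x y) → (∀ {x y} → R x y → T y x) →
  ∀ {xs} → AllPairs R xs → All (λ x → All (T x) xs) xs
allPairs⇒all-all reflexive forward backward []         = []
allPairs⇒all-all reflexive forward backward (Rx ∷ Rxs) =
  (reflexive ∷ All.map forward Rx) ∷
  All.zipWith (λ (r , rest) → backward r ∷ rest)
              (Rx , allPairs⇒all-all reflexive forward backward Rxs)

separated-++-toggle : ∀ {s} {S : List (Fin n)} → s ∉ S → ∀ {L} →
                      Separated (s ∷ S) L → Separated S (L ++ map (toggle s) L)
separated-++-toggle s∉S sep = AllPairs.++⁺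
  (AllPairs.map (_∘ agreeOutside-mono there) sep)
  (AllPairs.map⁺ (AllPairs.map (_∘ toggled) sep))
  (All.map All.map⁺ (allPairs⇒all-all (¬agreeOutside-toggle s∉S _)
    (_∘ agreeOutside-toggleʳ) (_∘ agreeOutside-sym ∘ agreeOutside-toggleʳ) sep))
  where
  toggled : ∀ {x y} → AgreeOutside _ (toggle _ x) (toggle _ y) → AgreeOutside _ x y
  toggled {x} x′~y′ = agreeOutside-trans (agreeOutside-toggle x) (agreeOutside-toggleʳ x′~y′)

unique⇒lookup-injective : ∀ {A : Set} {xs : List A} → Unique xs →
                          ∀ {i j} → List.lookup xs i ≡ List.lookup xs j → i ≡ j
unique⇒lookup-injective (_ ∷ _)    {Fin.zero}  {Fin.zero}  _ = refl
unique⇒lookup-injective (x≢xs ∷ _) {Fin.zero}  {Fin.suc j} e =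
  contradiction e (All.lookup x≢xs (∈-lookup j))
unique⇒lookup-injective (x≢xs ∷ _) {Fin.suc i} {Fin.zero}  e =
  contradiction (sym e) (All.lookup x≢xs (∈-lookup i))
unique⇒lookup-injective (_ ∷ uniq) {Fin.suc i} {Fin.suc j} e =
  cong Fin.suc (unique⇒lookup-injective uniq e)

encode : Vec Bool n → Fin (2 ^ n)
encode x = funToFin (Inverse.from 2↔Bool ∘ lookup x)

decode : Fin (2 ^ n) → Vec Bool n
decode k = tabulate (Inverse.to 2↔Bool ∘ finToFun k)

decode-encode : (x : Vec Bool n) → decode (encode x) ≡ x
decode-encode x = lookup-ext λ j → begin
  lookup (decode (encode x)) j   ≡⟨ lookup∘tabulate _ j ⟩
  to (finToFun (encode x) j)     ≡⟨ cong to (finToFun-funToFin _ j) ⟩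
  to (from (lookup x j))         ≡⟨ strictlyInverseˡ (lookup x j) ⟩
  lookup x j                     ∎
  where
  open ≡-Reasoning
  open Inverse 2↔Bool using (to; from; strictlyInverseˡ)

unique-length≤2^n : {L : List (Vec Bool n)} → Unique L → length L ≤ 2 ^ n
unique-length≤2^n uniqueL =
  injective⇒≤ (unique⇒lookup-injective uniqueL ∘ encode-injective)
  where
  encode-injective : ∀ {x y : Vec Bool _} → encode x ≡ encode y → x ≡ y
  encode-injective {x} {y} e = trans (sym (decode-encode x)) (trans (cong decode e) (decode-encode y))

separated-length : {S : List (Fin n)} → Unique S → {L : List (Vec Bool n)} →
                   Separated S L → length L * 2 ^ length S ≤ 2 ^ n
separated-length {n} {S = []}    []              {L} sep = begin
  length L * 1 ≡⟨ ℕ.*-identityʳ (length L) ⟩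
  length L     ≤⟨ unique-length≤2^n (AllPairs.map (_∘ λ { refl → agreeOutside-refl }) sep) ⟩
  2 ^ n        ∎
  where open ℕ.≤-Reasoning
separated-length {n} {S = s ∷ S} (s≢S ∷ uniqueS) {L} sep = begin
  length L * 2 ^ suc (length S)                ≡⟨ double (length L) (2 ^ length S) ⟩
  (length L + length L) * 2 ^ length S         ≡⟨ cong (_* 2 ^ length S) length-doubled ⟨
  length (L ++ map (toggle s) L) * 2 ^ length S ≤⟨ separated-length uniqueS (separated-++-toggle s∉S sep) ⟩
  2 ^ n                                        ∎
  where
  open ℕ.≤-Reasoning
  open +-*-Solver
  s∉S : s ∉ S
  s∉S s∈S = All.lookup s≢S s∈S refl
  double : ∀ a p → a * (2 * p) ≡ (a + a) * p
  double = solve 2 (λ a p → a :* (con 2 :* p) := (a :+ a) :* p) refl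
  length-doubled : length (L ++ map (toggle s) L) ≡ length L + length L
  length-doubled = trans (length-++ L) (cong (length L +_) (length-map (toggle s) L))

m*2^r≤2^n⇒m≤2^[n∸r] : ∀ a r n → a * 2 ^ r ≤ 2 ^ n → a ≤ 2 ^ (n ∸ r)
m*2^r≤2^n⇒m≤2^[n∸r] a r n a2ʳ≤2ⁿ = ℕ.*-cancelʳ-≤ a (2 ^ (n ∸ r)) (2 ^ r) {{ℕ.m^n≢0 2 r}} (begin
  a * 2 ^ r             ≤⟨ a2ʳ≤2ⁿ ⟩
  2 ^ n                 ≤⟨ ℕ.^-monoʳ-≤ 2 (ℕ.m≤n+m∸n n r) ⟩
  2 ^ (r + (n ∸ r))     ≡⟨ ℕ.^-distribˡ-+-* 2 r (n ∸ r) ⟩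
  2 ^ r * 2 ^ (n ∸ r)   ≡⟨ ℕ.*-comm (2 ^ r) (2 ^ (n ∸ r)) ⟩
  2 ^ (n ∸ r) * 2 ^ r   ∎)
  where open ℕ.≤-Reasoning

solution-separated : ∀ {A : Matrix m n} {S L} → IndependentCols A S → Unique S →
                     IsSolution A L → Unique L → Separated S L
solution-separated independent uniqueS (_ , completes , _ , consistent , solves) =
  allPairs-mapWithAll (λ sx sy x≢y x~y →
    independent (agreeing-solutions⇒dependent completes consistent sx sy x≢y uniqueS x~y)) solves

theorem1 : ∀ (m n : ℕ) (A : Matrix m n) (r : ℕ) → IsColMinRank A r → OptAtMost A (2 ^ (n ∸ r))
theorem1 m n A r ((S , uniqueS , |S|≡r , independent) , _) L uniqueL solution =
  m*2^r≤2^n⇒m≤2^[n∸r] (length L) r n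
    (subst (λ k → length L * 2 ^ k ≤ 2 ^ n) |S|≡r
      (separated-length uniqueS (solution-separated independent uniqueS solution uniqueL)))
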